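{- Let $j, k \in \mathbb{N}^+$ with $k > j$. Then $$B_{2k+j,k} = \sum_{\ell=2}^{k+j+1}\ell\binom{k+j-1}{\ell-2} - \sum_{\ell=3}^{j+2}\frac{\ell^2-\ell}{2}\binom{j-1}{\ell-3} - \sum_{i=1}^{j-1}\sum_{\ell=3}^{j-i+2}(\ell^2-\ell)\binom{j-i-1}{\ell-3} - 2.$$
   Context: For $n,k\in\mathbb{N}^+$, $B_{n,k}$ denotes the number of ways to split $n$ balls into any number of nonempty ordered bins so that the most crowded bin contains exactly $k$ balls, i.e. the number of compositions of $n$ (ordered tuples of positive integers of any length summing to $n$) whose largest part equals $k$. -}

module Defs where

open import Data.Nat using (ℕ; zero; suc; _+_; _*_; _∸_; _⊔_)
open import Data.Nat.Properties using (_≟_)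
open import Data.List using (List; []; _∷_; map; concatMap; upTo; length; filter; sum; foldr)
open import Data.Integer using (ℤ)
import Data.Integer as ℤ
open import Relation.Binary.PropositionalEquality using (_≡_)

-- compositionsFuel f n : all compositions of n (lists of positive naturals
-- summing to n), enumerated by choosing the first part p ∈ {1,…,n};
-- the fuel f ≥ n guarantees termination.
compositionsFuel : ℕ → ℕ → List (List ℕ)
compositionsFuel _       zero    = [] ∷ []
compositionsFuel zero    (suc n) = []
compositionsFuel (suc f) (suc n) =
  concatMap (λ p → map (suc p ∷_) (compositionsFuel f (suc n ∸ suc p))) (upTo (suc n))

compositions : ℕ → List (List ℕ)
compositions n = compositionsFuel n n

maxPart : List ℕ → ℕ
maxPart = foldr _⊔_ 0

B : ℕ → ℕ → ℕ
B n k = length (filter (λ c → maxPart c ≟ k) (compositions n))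

-- Σ_{ℓ = a}^{b} f ℓ  (empty when b < a), integer-valued.
sumFromTo : ℕ → ℕ → (ℕ → ℤ) → ℤ
sumFromTo a b f = foldr ℤ._+_ (ℤ.+ 0) (map (λ i → f (a + i)) (upTo (suc b ∸ a)))

-- Let B≤ n K count the compositions of n with all parts at most K. Classifying by the first part gives
-- B≤ (n+1) K = B≤ n K + ⋯ + B≤ (n+1-K) K, hence the recurrence B≤ (n+2) + B≤ (n+1-K) = 2 B≤ (n+1)
-- once n+1 ≥ K, and pure doubling before. Solving it on the three ranges n ≤ K, n ≤ 2K+1 and
-- n ≤ 3K+2 gives B≤ n K in closed form (powers of 2 times polynomials), and then
-- B (2k+j) k = B≤ (2k+j) k - B≤ (2k+j) (k-1), i.e.
--   8 B (2k+j) k = 2^(k+j+1) (k+j+3) - 2^(j-1) (3j² + 19j + 18).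
-- The three sums of the theorem are binomial transforms of quadratic polynomials, evaluated by
-- Pascal's rule, and they add up to the same value.

module Submission where

open import Defs
open import Data.Nat using (ℕ; zero; suc; _+_; _*_; _∸_; _<_; _≤_; _^_; _/_; s≤s)
open import Data.Nat.DivMod using (m*n/n≡m)
open import Data.Nat.Properties
open import Data.List using (List; []; _∷_; map; concat; concatMap; applyUpTo; upTo; length; filter; foldr; _++_)
open import Data.List.Properties using (map-cong; filter-++; length-++; filter-accept; filter-reject)
open import Function using (_∘_)
open import Data.Nat.Tactic.RingSolver using (solve-∀)
open import Data.Nat.Combinatorics using (_C_; nCk+nC[k+1]≡[n+1]C[k+1]; k>n⇒nCk≡0)
open import Relation.Nullary using (Dec; yes; no; ¬_)
open import Relation.Binary.Definitions using (tri<; tri≈; tri>)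
open import Relation.Binary.PropositionalEquality
open import Relation.Unary using (Pred; Decidable)
open import Level using (0ℓ)

∑ : ℕ → (ℕ → ℕ) → ℕ
∑ zero    f = 0
∑ (suc n) f = f 0 + ∑ n (f ∘ suc)

infix 5 ∑
syntax ∑ n (λ i → e) = ∑[ i < n ] e

∑-cong : ∀ n {f g : ℕ → ℕ} → (∀ i → f i ≡ g i) → ∑ n f ≡ ∑ n g
∑-cong zero    f≗g = refl
∑-cong (suc n) f≗g = cong₂ _+_ (f≗g 0) (∑-cong n (f≗g ∘ suc))

∑-zero : ∀ n → ∑[ i < n ] 0 ≡ 0
∑-zero zero    = refl
∑-zero (suc n) = ∑-zero n

∑-+ : ∀ n (f g : ℕ → ℕ) → ∑[ i < n ] (f i + g i) ≡ ∑ n f + ∑ n g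
∑-+ zero    f g = refl
∑-+ (suc n) f g = trans (cong (f 0 + g 0 +_) (∑-+ n (f ∘ suc) (g ∘ suc)))
                        (+-+-comm (f 0) (g 0) (∑ n (f ∘ suc)) (∑ n (g ∘ suc)))
  where
  +-+-comm : ∀ a b c d → a + b + (c + d) ≡ a + c + (b + d)
  +-+-comm = solve-∀

∑-last : ∀ n (f : ℕ → ℕ) → ∑ (suc n) f ≡ ∑ n f + f n
∑-last zero    f = +-comm (f 0) 0
∑-last (suc n) f = trans (cong (f 0 +_) (∑-last n (f ∘ suc))) (sym (+-assoc (f 0) _ _))

compositionsFuel-irrelevant : ∀ {f g n} → n ≤ f → n ≤ g →
  compositionsFuel f n ≡ compositionsFuel g n
compositionsFuel-irrelevant {n = zero} _ _ = refl
compositionsFuel-irrelevant {suc f} {suc g} {suc n} (s≤s n≤f) (s≤s n≤g) =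
  cong concat (map-cong tails (upTo (suc n)))
  where
  tails : ∀ p → map (suc p ∷_) (compositionsFuel f (n ∸ p)) ≡ map (suc p ∷_) (compositionsFuel g (n ∸ p))
  tails p = cong (map (suc p ∷_))
    (compositionsFuel-irrelevant (≤-trans (m∸n≤m n p) n≤f) (≤-trans (m∸n≤m n p) n≤g))

compositions-suc : ∀ n → compositions (suc n) ≡
  concatMap (λ p → map (suc p ∷_) (compositions (n ∸ p))) (upTo (suc n))
compositions-suc n = cong concat (map-cong tails (upTo (suc n)))
  where
  tails : ∀ p → map (suc p ∷_) (compositionsFuel n (n ∸ p)) ≡ map (suc p ∷_) (compositions (n ∸ p))
  tails p = cong (map (suc p ∷_)) (compositionsFuel-irrelevant (m∸n≤m n p) ≤-refl)

count : ∀ {A : Set} {P : Pred A 0ℓ} → Decidable P → List A → ℕ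
count P? xs = length (filter P? xs)

module _ {A : Set} {P : Pred A 0ℓ} (P? : Decidable P) where

  count-accept : ∀ x xs → P x → count P? (x ∷ xs) ≡ suc (count P? xs)
  count-accept x xs px = cong length (filter-accept P? {x} {xs} px)

  count-reject : ∀ x xs → ¬ P x → count P? (x ∷ xs) ≡ count P? xs
  count-reject x xs ¬px = cong length (filter-reject P? {x} {xs} ¬px)

  count-++ : ∀ xs ys → count P? (xs ++ ys) ≡ count P? xs + count P? ys
  count-++ xs ys = trans (cong length (filter-++ P? xs ys)) (length-++ (filter P? xs))

  count-concatMap : ∀ (F : ℕ → List A) f n →
    count P? (concatMap F (applyUpTo f n)) ≡ ∑[ i < n ] count P? (F (f i))
  count-concatMap F f zero    = refl
  count-concatMap F f (suc n) = trans (count-++ (F (f 0)) _)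
    (cong (count P? (F (f 0)) +_) (count-concatMap F (f ∘ suc) n))

maxPart≤? : ∀ K → Decidable (λ c → maxPart c ≤ K)
maxPart≤? K c = maxPart c ≤? K

maxPart≟ : ∀ K → Decidable (λ c → maxPart c ≡ K)
maxPart≟ K c = maxPart c ≟ K

#≤ : ℕ → List (List ℕ) → ℕ
#≤ K = count (maxPart≤? K)

#≡ : ℕ → List (List ℕ) → ℕ
#≡ K = count (maxPart≟ K)

B≤ : ℕ → ℕ → ℕ
B≤ n K = #≤ K (compositions n)

#≤-suc : ∀ K cs → #≤ (suc K) cs ≡ #≡ (suc K) cs + #≤ K cs
#≤-suc K [] = refl
#≤-suc K (c ∷ cs) with <-cmp (maxPart c) (suc K)
... | tri< (s≤s m≤K) m≢ _ = begin
  #≤ (suc K) (c ∷ cs)                 ≡⟨ count-accept (maxPart≤? (suc K)) c cs (m≤n⇒m≤1+n m≤K) ⟩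
  suc (#≤ (suc K) cs)                 ≡⟨ cong suc (#≤-suc K cs) ⟩
  suc (#≡ (suc K) cs + #≤ K cs)       ≡⟨ +-suc _ _ ⟨
  #≡ (suc K) cs + suc (#≤ K cs)       ≡⟨ cong₂ _+_ (count-reject (maxPart≟ (suc K)) c cs m≢)
                                                   (count-accept (maxPart≤? K) c cs m≤K) ⟨
  #≡ (suc K) (c ∷ cs) + #≤ K (c ∷ cs) ∎
  where open ≡-Reasoning
... | tri≈ _ m≡ _ = begin
  #≤ (suc K) (c ∷ cs)                 ≡⟨ count-accept (maxPart≤? (suc K)) c cs (≤-reflexive m≡) ⟩
  suc (#≤ (suc K) cs)                 ≡⟨ cong suc (#≤-suc K cs) ⟩
  suc (#≡ (suc K) cs + #≤ K cs)       ≡⟨ cong₂ _+_ (count-accept (maxPart≟ (suc K)) c cs m≡)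
                                                   (count-reject (maxPart≤? K) c cs (<⇒≱ (≤-reflexive (sym m≡)))) ⟨
  #≡ (suc K) (c ∷ cs) + #≤ K (c ∷ cs) ∎
  where open ≡-Reasoning
... | tri> _ m≢ m> = begin
  #≤ (suc K) (c ∷ cs)                 ≡⟨ count-reject (maxPart≤? (suc K)) c cs (<⇒≱ m>) ⟩
  #≤ (suc K) cs                       ≡⟨ #≤-suc K cs ⟩
  #≡ (suc K) cs + #≤ K cs             ≡⟨ cong₂ _+_ (count-reject (maxPart≟ (suc K)) c cs m≢)
                                                   (count-reject (maxPart≤? K) c cs (<⇒≱ (<-trans (n<1+n K) m>))) ⟨
  #≡ (suc K) (c ∷ cs) + #≤ K (c ∷ cs) ∎
  where open ≡-Reasoning

B≤-suc : ∀ n K → B≤ n (suc K) ≡ B n (suc K) + B≤ n K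
B≤-suc n K = #≤-suc K (compositions n)

#≤-map-∷-accept : ∀ {K p} → p < K → ∀ cs → #≤ K (map (suc p ∷_) cs) ≡ #≤ K cs
#≤-map-∷-accept             p<K []       = refl
#≤-map-∷-accept {K} {p} p<K (c ∷ cs) = by-cases (maxPart c ≤? K)
  where
  by-cases : Dec (maxPart c ≤ K) → #≤ K (map (suc p ∷_) (c ∷ cs)) ≡ #≤ K (c ∷ cs)
  by-cases (yes c≤K) = begin
    #≤ K ((suc p ∷ c) ∷ map (suc p ∷_) cs) ≡⟨ count-accept (maxPart≤? K) (suc p ∷ c) _ (⊔-lub p<K c≤K) ⟩
    suc (#≤ K (map (suc p ∷_) cs))         ≡⟨ cong suc (#≤-map-∷-accept p<K cs) ⟩
    suc (#≤ K cs)                          ≡⟨ count-accept (maxPart≤? K) c cs c≤K ⟨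
    #≤ K (c ∷ cs)                          ∎
    where open ≡-Reasoning
  by-cases (no c≰K) = begin
    #≤ K ((suc p ∷ c) ∷ map (suc p ∷_) cs) ≡⟨ count-reject (maxPart≤? K) (suc p ∷ c) _ (c≰K ∘ m⊔n≤o⇒n≤o (suc p) (maxPart c)) ⟩
    #≤ K (map (suc p ∷_) cs)               ≡⟨ #≤-map-∷-accept p<K cs ⟩
    #≤ K cs                                ≡⟨ count-reject (maxPart≤? K) c cs c≰K ⟨
    #≤ K (c ∷ cs)                          ∎
    where open ≡-Reasoning

#≤-map-∷-reject : ∀ {K p} → K ≤ p → ∀ cs → #≤ K (map (suc p ∷_) cs) ≡ 0
#≤-map-∷-reject             K≤p []       = refl
#≤-map-∷-reject {K} {p} K≤p (c ∷ cs) =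
  trans (count-reject (maxPart≤? K) (suc p ∷ c) _ (<⇒≱ (s≤s K≤p) ∘ m⊔n≤o⇒m≤o (suc p) (maxPart c)))
        (#≤-map-∷-reject K≤p cs)

𝟙[_<_] : ℕ → ℕ → ℕ
𝟙[ _     < zero  ] = 0
𝟙[ zero  < suc _ ] = 1
𝟙[ suc p < suc K ] = 𝟙[ p < K ]

𝟙[<]-yes : ∀ {p K} → p < K → 𝟙[ p < K ] ≡ 1
𝟙[<]-yes {zero}  {suc K} _         = refl
𝟙[<]-yes {suc p} {suc K} (s≤s p<K) = 𝟙[<]-yes p<K

𝟙[<]-no : ∀ {p K} → K ≤ p → 𝟙[ p < K ] ≡ 0
𝟙[<]-no {p}     {zero}  _         = refl
𝟙[<]-no {suc p} {suc K} (s≤s K≤p) = 𝟙[<]-no K≤p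

#≤-map-∷ : ∀ K p cs → #≤ K (map (suc p ∷_) cs) ≡ 𝟙[ p < K ] * #≤ K cs
#≤-map-∷ K p cs with p <? K
... | yes p<K = trans (#≤-map-∷-accept p<K cs)
                      (sym (trans (cong (_* #≤ K cs) (𝟙[<]-yes p<K)) (*-identityˡ _)))
... | no  p≮K = trans (#≤-map-∷-reject (≮⇒≥ p≮K) cs) (sym (cong (_* #≤ K cs) (𝟙[<]-no (≮⇒≥ p≮K))))

B≤-suc-∑ : ∀ n K → B≤ (suc n) K ≡ ∑[ p < suc n ] 𝟙[ p < K ] * B≤ (n ∸ p) K
B≤-suc-∑ n K = begin
  #≤ K (compositions (suc n))
    ≡⟨ cong (#≤ K) (compositions-suc n) ⟩
  #≤ K (concatMap (λ p → map (suc p ∷_) (compositions (n ∸ p))) (upTo (suc n)))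
    ≡⟨ count-concatMap (maxPart≤? K) (λ p → map (suc p ∷_) (compositions (n ∸ p))) (λ p → p) (suc n) ⟩
  ∑[ p < suc n ] #≤ K (map (suc p ∷_) (compositions (n ∸ p)))
    ≡⟨ ∑-cong (suc n) (λ p → #≤-map-∷ K p (compositions (n ∸ p))) ⟩
  ∑[ p < suc n ] 𝟙[ p < K ] * B≤ (n ∸ p) K ∎
  where open ≡-Reasoning

B≤-suc-zero : ∀ n → B≤ (suc n) 0 ≡ 0
B≤-suc-zero n = trans (B≤-suc-∑ n 0) (∑-zero (suc n))

module _ (f : ℕ → ℕ) where

  window : ℕ → ℕ → ℕ
  window K n = ∑[ p < suc n ] 𝟙[ p < K ] * f (n ∸ p)

  window-suc : ∀ K n → window (suc K) n ≡ window K n + 𝟙[ K < suc n ] * f (n ∸ K)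
  window-suc zero    zero    = +-comm (1 * f 0) 0
  window-suc (suc K) zero    = sym (+-identityʳ _)
  window-suc zero    (suc n) = +-comm (1 * f (suc n)) _
  window-suc (suc K) (suc n) = begin
    1 * f (suc n) + window (suc K) n                          ≡⟨ cong (1 * f (suc n) +_) (window-suc K n) ⟩
    1 * f (suc n) + (window K n + 𝟙[ K < suc n ] * f (n ∸ K)) ≡⟨ +-assoc (1 * f (suc n)) _ _ ⟨
    1 * f (suc n) + window K n + 𝟙[ K < suc n ] * f (n ∸ K)   ∎
    where open ≡-Reasoning

B≤-recurrence : ∀ K n → B≤ (2 + n) K + 𝟙[ K < 2 + n ] * B≤ (suc n ∸ K) K ≡ 2 * B≤ (suc n) K
B≤-recurrence zero n rewrite B≤-suc-zero n | B≤-suc-zero (suc n) = refl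
B≤-recurrence (suc K) n = begin
  B≤ (2 + n) (suc K) + 𝟙[ K < suc n ] * f (n ∸ K)         ≡⟨ cong (_+ 𝟙[ K < suc n ] * f (n ∸ K)) (B≤-suc-∑ (suc n) (suc K)) ⟩
  1 * f (suc n) + window f K n + 𝟙[ K < suc n ] * f (n ∸ K) ≡⟨ +-assoc (1 * f (suc n)) _ _ ⟩
  1 * f (suc n) + (window f K n + 𝟙[ K < suc n ] * f (n ∸ K)) ≡⟨ cong (1 * f (suc n) +_) (window-suc f K n) ⟨
  1 * f (suc n) + window f (suc K) n                          ≡⟨ cong (1 * f (suc n) +_) (B≤-suc-∑ n (suc K)) ⟨
  1 * f (suc n) + f (suc n)                                   ≡⟨ cong (_+ f (suc n)) (*-identityˡ (f (suc n))) ⟩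
  f (suc n) + f (suc n)                                       ≡⟨ cong (f (suc n) +_) (+-identityʳ (f (suc n))) ⟨
  2 * f (suc n)                                               ∎
  where
  open ≡-Reasoning
  f : ℕ → ℕ
  f m = B≤ m (suc K)

B≤-double : ∀ {K n} → 2 + n ≤ K → B≤ (2 + n) K ≡ 2 * B≤ (suc n) K
B≤-double {K} {n} 2+n≤K = begin
  B≤ (2 + n) K                                        ≡⟨ +-identityʳ _ ⟨
  B≤ (2 + n) K + 0                                    ≡⟨ cong (λ e → B≤ (2 + n) K + e * B≤ (suc n ∸ K) K) (𝟙[<]-no 2+n≤K) ⟨
  B≤ (2 + n) K + 𝟙[ K < 2 + n ] * B≤ (suc n ∸ K) K ≡⟨ B≤-recurrence K n ⟩
  2 * B≤ (suc n) K                                    ∎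
  where open ≡-Reasoning

B≤-recurrence-≥ : ∀ {K n} → K ≤ suc n → B≤ (2 + n) K + B≤ (suc n ∸ K) K ≡ 2 * B≤ (suc n) K
B≤-recurrence-≥ {K} {n} K≤1+n = begin
  B≤ (2 + n) K + B≤ (suc n ∸ K) K                     ≡⟨ cong (B≤ (2 + n) K +_) (*-identityˡ _) ⟨
  B≤ (2 + n) K + 1 * B≤ (suc n ∸ K) K                 ≡⟨ cong (λ e → B≤ (2 + n) K + e * B≤ (suc n ∸ K) K) (𝟙[<]-yes (s≤s K≤1+n)) ⟨
  B≤ (2 + n) K + 𝟙[ K < 2 + n ] * B≤ (suc n ∸ K) K ≡⟨ B≤-recurrence K n ⟩
  2 * B≤ (suc n) K                                    ∎
  where open ≡-Reasoning

-- All linear arithmetic below is done in this additive form, avoiding truncated subtraction.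
+-cancel-by : ∀ {l r x y} → x ≡ y → l + y ≡ r + x → l ≡ r
+-cancel-by {l} {r} {x} {y} x≡y eq = +-cancelʳ-≡ y l r (trans eq (cong (r +_) x≡y))

B≤-small : ∀ {K r} → r < K → B≤ (suc r) K ≡ 2 ^ r
B≤-small {suc K} {zero}  _       = refl
B≤-small {K}     {suc r} 2+r≤K = trans (B≤-double 2+r≤K) (cong (2 *_) (B≤-small (<⇒≤ 2+r≤K)))

B≤-middle : ∀ {K r} → r ≤ K → 2 * B≤ (suc r + K) K + (r + 2) * 2 ^ r ≡ 2 * 2 ^ K * 2 ^ r
B≤-middle {zero}  {zero} _ = refl
B≤-middle {suc K} {zero} _ = begin
  2 * B≤ (2 + K) (suc K) + 2 * 1         ≡⟨ *-distribˡ-+ 2 (B≤ (2 + K) (suc K)) 1 ⟨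
  2 * (B≤ (2 + K) (suc K) + 1)           ≡⟨ cong (λ m → 2 * (B≤ (2 + K) (suc K) + B≤ m (suc K))) (n∸n≡0 K) ⟨
  2 * (B≤ (2 + K) (suc K) + B≤ (K ∸ K) (suc K)) ≡⟨ cong (2 *_) (B≤-recurrence-≥ {suc K} {K} ≤-refl) ⟩
  2 * (2 * B≤ (suc K) (suc K))           ≡⟨ cong (λ e → 2 * (2 * e)) (B≤-small {suc K} {K} ≤-refl) ⟩
  2 * (2 * 2 ^ K)                        ≡⟨ *-identityʳ _ ⟨
  2 * 2 ^ suc K * 2 ^ 0                  ∎
  where open ≡-Reasoning
B≤-middle {K} {suc r} 1+r≤K = +-cancel-by
  (cong₂ (λ u v → 2 * u + 2 * v) recurrence (B≤-middle (<⇒≤ 1+r≤K)))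
  (identity (B≤ (2 + r + K) K) (B≤ (suc r + K) K) (2 ^ r) (2 ^ K) r)
  where
  recurrence : B≤ (2 + r + K) K + 2 ^ r ≡ 2 * B≤ (suc r + K) K
  recurrence = begin
    B≤ (2 + r + K) K + 2 ^ r                     ≡⟨ cong (B≤ (2 + r + K) K +_) (B≤-small 1+r≤K) ⟨
    B≤ (2 + r + K) K + B≤ (suc r) K              ≡⟨ cong (λ m → B≤ (2 + r + K) K + B≤ m K) (m+n∸n≡m (suc r) K) ⟨
    B≤ (2 + r + K) K + B≤ (suc r + K ∸ K) K      ≡⟨ B≤-recurrence-≥ {K} {r + K} (m≤n+m K (suc r)) ⟩
    2 * B≤ (suc r + K) K                         ∎
    where open ≡-Reasoning
  identity : ∀ F₂ F₁ P U r →
    2 * F₂ + (suc r + 2) * (2 * P) + (2 * (2 * F₁) + 2 * (2 * U * P))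
      ≡ 2 * U * (2 * P) + (2 * (F₂ + P) + 2 * (2 * F₁ + (r + 2) * P))
  identity = solve-∀

B≤-large : ∀ {K s} → s ≤ suc K →
  8 * B≤ (suc (s + K + K)) K + (2 + s + K) * (4 * 2 ^ K * 2 ^ s)
    ≡ 8 * 2 ^ K * 2 ^ K * 2 ^ s + s * (s + 3) * 2 ^ s
B≤-large {K} {zero} _ = +-cancel-by
  (cong (4 *_) (B≤-middle {K} {K} ≤-refl))
  (identity (B≤ (suc K + K) K) (2 ^ K) K)
  where
  identity : ∀ F U K →
    8 * F + (2 + K) * (4 * U * 1) + 4 * (2 * U * U)
      ≡ 8 * U * U * 1 + 0 * 3 * 1 + 4 * (2 * F + (K + 2) * U)
  identity = solve-∀
B≤-large {K} {suc s} (s≤s s≤K) = +-cancel-by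
  (cong₂ _+_ (cong₂ (λ u v → 8 * u + 2 * v) recurrence (B≤-large (m≤n⇒m≤1+n s≤K)))
             (cong (4 *_) (sym (B≤-middle s≤K))))
  (identity (B≤ (suc (suc s + K + K)) K) (B≤ (suc (s + K + K)) K) (B≤ (suc s + K) K) (2 ^ s) (2 ^ K) s K)
  where
  recurrence : B≤ (suc (suc s + K + K)) K + B≤ (suc s + K) K ≡ 2 * B≤ (suc (s + K + K)) K
  recurrence = begin
    B≤ (suc (suc s + K + K)) K + B≤ (suc s + K) K           ≡⟨ cong (λ m → B≤ (suc (suc s + K + K)) K + B≤ m K) (m+n∸n≡m (suc s + K) K) ⟨
    B≤ (suc (suc s + K + K)) K + B≤ (suc s + K + K ∸ K) K   ≡⟨ B≤-recurrence-≥ {K} {s + K + K} (m≤n+m K (suc s + K)) ⟩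
    2 * B≤ (suc (s + K + K)) K                              ∎
    where open ≡-Reasoning
  identity : ∀ F₂ F₁ M P U s K →
    8 * F₂ + (2 + suc s + K) * (4 * U * (2 * P))
      + (8 * (2 * F₁) + 2 * (8 * U * U * P + s * (s + 3) * P) + 4 * (2 * M + (s + 2) * P))
      ≡ 8 * U * U * (2 * P) + suc s * (suc s + 3) * (2 * P)
      + (8 * (F₂ + M) + 2 * (8 * F₁ + (2 + s + K) * (4 * U * P)) + 4 * (2 * U * P))
  identity = solve-∀

B-closed : ∀ {k a} → suc a < k →
  8 * B (2 * k + suc a) k + 2 ^ a * (3 * a * a + 25 * a + 40) ≡ 4 * 2 ^ k * 2 ^ a * (k + a + 4)
B-closed {suc K} {a} 2+a≤1+K = +-cancel-by
  (cong₂ _+_ (cong₂ (λ u v → 8 * u + v) (sym (B≤-suc n K)) largeₖ) (sym largeₖ₋₁))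
  (identity (B n (suc K)) (B≤ n (suc K)) (B≤ n K) (2 ^ a) (2 ^ K) a K)
  where
  n = 2 * suc K + suc a
  largeₖ : 8 * B≤ n (suc K) + (2 + a + suc K) * (4 * 2 ^ suc K * 2 ^ a)
             ≡ 8 * 2 ^ suc K * 2 ^ suc K * 2 ^ a + a * (a + 3) * 2 ^ a
  largeₖ = trans (cong (λ m → 8 * B≤ m (suc K) + (2 + a + suc K) * (4 * 2 ^ suc K * 2 ^ a)) (index a K))
             (B≤-large {suc K} {a} (m≤n⇒m≤1+n (≤-trans (m≤n+m a 2) 2+a≤1+K)))
    where
    index : ∀ a K → 2 * suc K + suc a ≡ suc (a + suc K + suc K)
    index = solve-∀
  largeₖ₋₁ : 8 * B≤ n K + (4 + a + K) * (4 * 2 ^ K * 2 ^ (2 + a))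
               ≡ 8 * 2 ^ K * 2 ^ K * 2 ^ (2 + a) + (2 + a) * (2 + a + 3) * 2 ^ (2 + a)
  largeₖ₋₁ = trans (cong (λ m → 8 * B≤ m K + (4 + a + K) * (4 * 2 ^ K * 2 ^ (2 + a))) (index a K)) (B≤-large {K} {2 + a} 2+a≤1+K)
    where
    index : ∀ a K → 2 * suc K + suc a ≡ suc (2 + a + K + K)
    index = solve-∀
  identity : ∀ B A₁ A₀ P U a K →
    8 * B + P * (3 * a * a + 25 * a + 40)
      + (8 * A₁ + (8 * (2 * U) * (2 * U) * P + a * (a + 3) * P)
         + (8 * A₀ + (4 + a + K) * (4 * U * (2 * (2 * P)))))
      ≡ 4 * (2 * U) * P * (suc K + a + 4)
      + (8 * (B + A₀) + (8 * A₁ + (2 + a + suc K) * (4 * (2 * U) * P))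
         + (8 * U * U * (2 * (2 * P)) + (2 + a) * (2 + a + 3) * (2 * (2 * P))))
  identity = solve-∀

∑binom : ℕ → (ℕ → ℕ) → ℕ
∑binom J g = ∑[ t < suc J ] g t * (J C t)

∑binom-suc : ∀ J g → ∑binom (suc J) g ≡ ∑binom J (λ t → g t + g (suc t))
∑binom-suc J g = begin
  g 0 * 1 + (∑[ t < suc J ] g (suc t) * (suc J C suc t))
    ≡⟨ cong (g 0 * 1 +_) (∑-cong (suc J) (λ t → trans (cong (g (suc t) *_) (sym (nCk+nC[k+1]≡[n+1]C[k+1] J t)))
                                                        (*-distribˡ-+ (g (suc t)) (J C t) (J C suc t)))) ⟩
  g 0 * 1 + (∑[ t < suc J ] (g (suc t) * (J C t) + g (suc t) * (J C suc t)))
    ≡⟨ cong (g 0 * 1 +_) (∑-+ (suc J) (λ t → g (suc t) * (J C t)) (λ t → g (suc t) * (J C suc t))) ⟩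
  g 0 * 1 + (V + (∑[ t < suc J ] g (suc t) * (J C suc t)))
    ≡⟨ cong (λ z → g 0 * 1 + (V + z)) (∑-last J (λ t → g (suc t) * (J C suc t))) ⟩
  g 0 * 1 + (V + (U + g (suc J) * (J C suc J)))
    ≡⟨ cong (λ z → g 0 * 1 + (V + (U + g (suc J) * z))) (k>n⇒nCk≡0 (n<1+n J)) ⟩
  g 0 * 1 + (V + (U + g (suc J) * 0))
    ≡⟨ rearrange (g 0) V U (g (suc J)) ⟩
  (g 0 * 1 + U) + V
    ≡⟨ ∑-+ (suc J) (λ t → g t * (J C t)) (λ t → g (suc t) * (J C t)) ⟨
  ∑[ t < suc J ] (g t * (J C t) + g (suc t) * (J C t))
    ≡⟨ ∑-cong (suc J) (λ t → sym (*-distribʳ-+ (J C t) (g t) (g (suc t)))) ⟩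
  ∑binom J (λ t → g t + g (suc t)) ∎
  where
  open ≡-Reasoning
  V = ∑[ t < suc J ] g (suc t) * (J C t)
  U = ∑[ t < J ] g (suc t) * (J C suc t)
  rearrange : ∀ a v u b → a * 1 + (v + (u + b * 0)) ≡ (a * 1 + u) + v
  rearrange = solve-∀

-- The binomial moments ∑ C(J,t) = 2^J, ∑ t C(J,t) = J 2^(J-1), ∑ t² C(J,t) = J (J+1) 2^(J-2), scaled by 4.
∑binom-quadratic : ∀ J (g : ℕ → ℕ) a b c d → (∀ t → d * g t ≡ a + b * t + c * (t * t)) →
  4 * (d * ∑binom J g) ≡ 2 ^ J * (4 * a + 2 * b * J + c * J * suc J)
∑binom-quadratic zero g a b c d g≡ = +-cancel-by (cong (4 *_) (g≡ 0)) (identity d (g 0) a b c)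
  where
  identity : ∀ d x a b c → 4 * (d * (x * 1 + 0)) + 4 * (a + b * 0 + c * (0 * 0)) ≡ 1 * (4 * a + 2 * b * 0 + c * 0 * 1) + 4 * (d * x)
  identity = solve-∀
∑binom-quadratic (suc J) g a b c d g≡ = begin
  4 * (d * ∑binom (suc J) g) ≡⟨ cong (λ z → 4 * (d * z)) (∑binom-suc J g) ⟩
  4 * (d * ∑binom J g′)      ≡⟨ ∑binom-quadratic J g′ (2 * a + b + c) (2 * b + 2 * c) (2 * c) d g′≡ ⟩
  2 ^ J * (4 * (2 * a + b + c) + 2 * (2 * b + 2 * c) * J + 2 * c * J * suc J) ≡⟨ doubled (2 ^ J) a b c J ⟩
  2 ^ suc J * (4 * a + 2 * b * suc J + c * suc J * suc (suc J)) ∎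
  where
  open ≡-Reasoning
  g′ : ℕ → ℕ
  g′ t = g t + g (suc t)
  shifted : ∀ a b c t → a + b * t + c * (t * t) + (a + b * suc t + c * (suc t * suc t)) ≡ (2 * a + b + c) + (2 * b + 2 * c) * t + 2 * c * (t * t)
  shifted = solve-∀
  g′≡ : ∀ t → d * g′ t ≡ (2 * a + b + c) + (2 * b + 2 * c) * t + 2 * c * (t * t)
  g′≡ t = trans (*-distribˡ-+ d (g t) (g (suc t))) (trans (cong₂ _+_ (g≡ t) (g≡ (suc t))) (shifted a b c t))
  doubled : ∀ p a b c J → p * (4 * (2 * a + b + c) + 2 * (2 * b + 2 * c) * J + 2 * c * J * suc J) ≡ (2 * p) * (4 * a + 2 * b * suc J + c * suc J * suc (suc J))
  doubled = solve-∀

pronic : ℕ → ℕ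
pronic ℓ = ℓ * ℓ ∸ ℓ

pronic-suc : ∀ n → pronic (suc n) ≡ n * suc n
pronic-suc n = m+n∸m≡n (suc n) (n * suc n)

triangle : ℕ → ℕ
triangle zero    = 0
triangle (suc n) = suc n + triangle n

triangle-double : ∀ n → 2 * triangle n ≡ n * suc n
triangle-double zero    = refl
triangle-double (suc n) = begin
  2 * (suc n + triangle n)       ≡⟨ *-distribˡ-+ 2 (suc n) (triangle n) ⟩
  2 * suc n + 2 * triangle n     ≡⟨ cong (2 * suc n +_) (triangle-double n) ⟩
  2 * suc n + n * suc n          ≡⟨ *-distribʳ-+ (suc n) 2 n ⟨
  suc (suc n) * suc n            ≡⟨ *-comm (suc (suc n)) (suc n) ⟩
  suc n * suc (suc n)            ∎
  where open ≡-Reasoning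

pronic-half : ∀ n → pronic (suc n) / 2 ≡ triangle n
pronic-half n = begin
  pronic (suc n) / 2      ≡⟨ cong (_/ 2) (pronic-suc n) ⟩
  n * suc n / 2           ≡⟨ cong (_/ 2) (triangle-double n) ⟨
  2 * triangle n / 2      ≡⟨ cong (_/ 2) (*-comm 2 (triangle n)) ⟩
  triangle n * 2 / 2      ≡⟨ m*n/n≡m (triangle n) 2 ⟩
  triangle n              ∎
  where open ≡-Reasoning

∑binom-pronic : ∀ J → 4 * (1 * ∑binom J (λ t → pronic (3 + t))) ≡ 2 ^ J * (4 * 6 + 2 * 5 * J + 1 * J * suc J)
∑binom-pronic J = ∑binom-quadratic J (λ t → pronic (3 + t)) 6 5 1 1 λ t →
  trans (*-identityˡ _) (trans (pronic-suc (2 + t)) (expand t))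
  where
  expand : ∀ t → (2 + t) * (3 + t) ≡ 6 + 5 * t + 1 * (t * t)
  expand = solve-∀

∑binom-pronic-half : ∀ J → 4 * (2 * ∑binom J (λ t → pronic (3 + t) / 2)) ≡ 2 ^ J * (4 * 6 + 2 * 5 * J + 1 * J * suc J)
∑binom-pronic-half J = ∑binom-quadratic J (λ t → pronic (3 + t) / 2) 6 5 1 2 λ t →
  trans (cong (2 *_) (pronic-half (2 + t))) (trans (triangle-double (2 + t)) (expand t))
  where
  expand : ∀ t → (2 + t) * (3 + t) ≡ 6 + 5 * t + 1 * (t * t)
  expand = solve-∀

nestedPronicSum : ℕ → ℕ
nestedPronicSum a = ∑[ i < a ] ∑[ t < a ∸ i ] pronic (3 + t) * ((a ∸ i ∸ 1) C t)

nestedPronicSum-closed : ∀ a → 4 * nestedPronicSum a + 8 ≡ 2 ^ a * (a * a + 7 * a + 8)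
nestedPronicSum-closed zero    = refl
nestedPronicSum-closed (suc a) = +-cancel-by
  (cong₂ _+_ (∑binom-pronic a) (nestedPronicSum-closed a))
  (identity (∑binom a (λ t → pronic (3 + t))) (nestedPronicSum a) (2 ^ a) a)
  where
  identity : ∀ G S P a →
    4 * (G + S) + 8 + (P * (4 * 6 + 2 * 5 * a + 1 * a * suc a) + P * (a * a + 7 * a + 8))
      ≡ 2 * P * (suc a * suc a + 7 * suc a + 8) + (4 * (1 * G) + (4 * S + 8))
  identity = solve-∀

B-sum-identity : ∀ {K a} → suc a < suc K →
  B (2 * suc K + suc a) (suc K)
    + ∑binom a (λ t → pronic (3 + t) / 2)
    + nestedPronicSum a
    + 2
  ≡ ∑binom (K + suc a) (2 +_)
B-sum-identity {K} {a} 2+a≤1+K = *-cancelˡ-≡ _ _ 8 (+-cancel-by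
  (cong₂ _+_ (cong₂ _+_ (cong₂ _+_ (B-closed 2+a≤1+K) (∑binom-pronic-half a)) (cong (2 *_) (nestedPronicSum-closed a)))
             (cong (2 *_) (sym first)))
  (identity (B (2 * suc K + suc a) (suc K)) (∑binom (K + suc a) (2 +_)) (∑binom a (λ t → pronic (3 + t) / 2))
            (nestedPronicSum a) (2 ^ a) (2 ^ K) a K))
  where
  first : 4 * (1 * ∑binom (K + suc a) (2 +_)) ≡ 2 ^ K * 2 ^ suc a * (4 * 2 + 2 * 1 * (K + suc a) + 0 * (K + suc a) * suc (K + suc a))
  first = trans (∑binom-quadratic (K + suc a) (2 +_) 2 1 0 1 (λ t → expand t))
                (cong (_* (4 * 2 + 2 * 1 * (K + suc a) + 0 * (K + suc a) * suc (K + suc a))) (^-distribˡ-+-* 2 K (suc a)))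
    where
    expand : ∀ t → 1 * (2 + t) ≡ 2 + 1 * t + 0 * (t * t)
    expand = solve-∀
  identity : ∀ B S₁ S₂ S₃ P U a K →
    8 * (B + S₂ + S₃ + 2)
      + (4 * (2 * U) * P * (suc K + a + 4) + P * (4 * 6 + 2 * 5 * a + 1 * a * suc a)
         + 2 * (P * (a * a + 7 * a + 8)) + 2 * (4 * (1 * S₁)))
      ≡ 8 * S₁
      + (8 * B + P * (3 * a * a + 25 * a + 40) + 4 * (2 * S₂) + 2 * (4 * S₃ + 8)
         + 2 * (U * (2 * P) * (4 * 2 + 2 * 1 * (K + suc a) + 0 * (K + suc a) * suc (K + suc a))))
  identity = solve-∀

open import Data.Integer using (ℤ; +_; _-_)
import Data.Integer as ℤ
open import Data.Integer.Properties using (pos-+)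
open import Data.Integer.Tactic.RingSolver renaming (solve-∀ to ℤ-solve-∀)

module _ {h : ℕ → ℤ} (H : ℕ → ℕ) (h≡H : ∀ i → h i ≡ + H i) where

  sumFromTo-∑ : ∀ a b → sumFromTo a b h ≡ + (∑[ i < suc b ∸ a ] H (a + i))
  sumFromTo-∑ a b = foldr-map (suc b ∸ a) (λ i → i)
    where
    foldr-map : ∀ n f → foldr ℤ._+_ (+ 0) (map (λ i → h (a + i)) (applyUpTo f n)) ≡ + (∑[ i < n ] H (a + f i))
    foldr-map zero    f = refl
    foldr-map (suc n) f = trans (cong₂ ℤ._+_ (h≡H (a + f 0)) (foldr-map n (f ∘ suc))) (sym (pos-+ (H (a + f 0)) _))

  sumFromTo-∑-offset : ∀ a m → sumFromTo (suc a) (m + a) h ≡ + (∑[ i < m ] H (suc a + i))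
  sumFromTo-∑-offset a m = trans (sumFromTo-∑ (suc a) (m + a)) (cong (λ n → + (∑[ i < n ] H (suc a + i))) (m+n∸n≡m m a))

b+x+y+z≡s⇒b≡s-x-y-z : ∀ {b x y z s} → b + x + y + z ≡ s → + b ≡ + s - + x - + y - + z
b+x+y+z≡s⇒b≡s-x-y-z {b} {x} {y} {z} refl
  rewrite pos-+ (b + x + y) z | pos-+ (b + x) y | pos-+ b x = identity (+ b) (+ x) (+ y) (+ z)
  where
  identity : ∀ b x y z → b ≡ b ℤ.+ x ℤ.+ y ℤ.+ z - x - y - z
  identity = ℤ-solve-∀

mainTheorem12 : (j k : ℕ) → 1 Data.Nat.≤ j → j < k →
    + B (2 * k + j) k ≡
      sumFromTo 2 (k + j + 1) (λ ℓ → + (ℓ * ((k + j ∸ 1) C (ℓ ∸ 2))))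
      - sumFromTo 3 (j + 2) (λ ℓ → + (((ℓ * ℓ ∸ ℓ) / 2) * ((j ∸ 1) C (ℓ ∸ 3))))
      - sumFromTo 1 (j ∸ 1) (λ i →
          sumFromTo 3 (j ∸ i + 2) (λ ℓ → + ((ℓ * ℓ ∸ ℓ) * ((j ∸ i ∸ 1) C (ℓ ∸ 3)))))
      - + 2
mainTheorem12 (suc a) (suc K) _ 2+a≤1+K =
  trans (b+x+y+z≡s⇒b≡s-x-y-z (B-sum-identity 2+a≤1+K))
        (sym (cong₂ (λ u v → u - v - + 2) (cong₂ _-_ first second) third))
  where
  first : sumFromTo 2 (suc K + suc a + 1) (λ ℓ → + (ℓ * ((K + suc a) C (ℓ ∸ 2)))) ≡ + ∑binom (K + suc a) (λ t → 2 + t)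
  first = sumFromTo-∑-offset (λ ℓ → ℓ * ((K + suc a) C (ℓ ∸ 2))) (λ _ → refl) 1 (suc K + suc a)
  second : sumFromTo 3 (suc a + 2) (λ ℓ → + (pronic ℓ / 2 * (a C (ℓ ∸ 3)))) ≡ + ∑binom a (λ t → pronic (3 + t) / 2)
  second = sumFromTo-∑-offset (λ ℓ → pronic ℓ / 2 * (a C (ℓ ∸ 3))) (λ _ → refl) 2 (suc a)
  inner : ∀ x → sumFromTo 3 (x + 2) (λ ℓ → + (pronic ℓ * ((x ∸ 1) C (ℓ ∸ 3)))) ≡ + (∑[ t < x ] pronic (3 + t) * ((x ∸ 1) C t))
  inner x = sumFromTo-∑-offset (λ ℓ → pronic ℓ * ((x ∸ 1) C (ℓ ∸ 3))) (λ _ → refl) 2 x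
  third : sumFromTo 1 a (λ i → sumFromTo 3 (suc a ∸ i + 2) (λ ℓ → + (pronic ℓ * ((suc a ∸ i ∸ 1) C (ℓ ∸ 3)))))
            ≡ + nestedPronicSum a
  third = sumFromTo-∑ (λ i → ∑[ t < suc a ∸ i ] pronic (3 + t) * ((suc a ∸ i ∸ 1) C t)) (λ i → inner (suc a ∸ i)) 1 a
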